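{- Let $(\mathbb{A},\mathcal{A})$ be a kit. Assuming the axiom of choice, every presheaf $X\in\mathrm{StPSh}(\mathbb{A},\mathcal{A})$ has a representation $X\cong\coprod_{i\in I}\mathrm{y}(a_i)/G_i$ where each $a_i\in\mathbb{A}$ and $G_i\in\mathcal{A}(a_i)$.
   Context: A kit on a groupoid $\mathbb{A}$ is a family $\mathcal{A}(a)$ of sets of subgroups of $\mathrm{End}(a)=\mathbb{A}(a,a)$ closed under conjugation by morphisms of $\mathbb{A}$. $\mathrm{StPSh}(\mathbb{A},\mathcal{A})$ is the full subcategory of presheaves $X:\mathbb{A}^{op}\to\mathbf{Set}$ such that for every $a$ and $x\in X(a)$, the stabilizer $\{\alpha\in\mathrm{End}(a):x\cdot\alpha=x\}$ belongs to $\mathcal{A}(a)$. For $a\in\mathbb{A}$ and $G\le\mathrm{End}(a)$, $\mathrm{y}(a)/G$ is the quotient of the representable presheaf $\mathrm{y}(a)$ by $G$: it sends $a'$ to $\mathbb{A}(a',a)/\!\sim_G$ where $\gamma'\sim_G\gamma$ iff $\gamma'\circ\gamma^{ -1}\in G$. -}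

module Defs where

open import Level using (Level; 0ℓ; suc)
open import Data.Product using (Σ; Σ-syntax; ∃; _×_; _,_; proj₁; proj₂)
open import Function.Bundles using (_⇔_)
open import Relation.Binary.Bundles using (Setoid)
open import Relation.Binary.Structures using (IsEquivalence)
open import Relation.Binary.PropositionalEquality
  using (_≡_; refl; sym; trans; cong; cong₂; subst; module ≡-Reasoning)

-- Groupoids (hom-sets are sets with propositional equality).
-- Convention: _∘_ : Hom b c → Hom a b → Hom a c.

record Groupoid : Set₁ where
  infixr 9 _∘_
  field
    Obj   : Set
    Hom   : Obj → Obj → Set
    id    : ∀ {a} → Hom a a
    _∘_   : ∀ {a b c} → Hom b c → Hom a b → Hom a c
    inv   : ∀ {a b} → Hom a b → Hom b a
    assoc : ∀ {a b c d} (h : Hom c d) (g : Hom b c) (f : Hom a b) →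
            (h ∘ g) ∘ f ≡ h ∘ (g ∘ f)
    idˡ   : ∀ {a b} (f : Hom a b) → id ∘ f ≡ f
    idʳ   : ∀ {a b} (f : Hom a b) → f ∘ id ≡ f
    invˡ  : ∀ {a b} (f : Hom a b) → inv f ∘ f ≡ id
    invʳ  : ∀ {a b} (f : Hom a b) → f ∘ inv f ≡ id

  End : Obj → Set
  End a = Hom a a

module GroupoidLemmas (𝔸 : Groupoid) where
  open Groupoid 𝔸
  open ≡-Reasoning

  inv-unique : ∀ {a b} (f : Hom a b) (h : Hom b a) → h ∘ f ≡ id → h ≡ inv f
  inv-unique f h p = begin
    h                   ≡⟨ sym (idʳ h) ⟩
    h ∘ id              ≡⟨ cong (h ∘_) (sym (invʳ f)) ⟩
    h ∘ (f ∘ inv f)     ≡⟨ sym (assoc h f (inv f)) ⟩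
    (h ∘ f) ∘ inv f     ≡⟨ cong (_∘ inv f) p ⟩
    id ∘ inv f          ≡⟨ idˡ (inv f) ⟩
    inv f               ∎

  inv-∘ : ∀ {a b c} (g : Hom b c) (f : Hom a b) → inv (g ∘ f) ≡ inv f ∘ inv g
  inv-∘ g f = sym (inv-unique (g ∘ f) (inv f ∘ inv g) (begin
    (inv f ∘ inv g) ∘ (g ∘ f)   ≡⟨ assoc (inv f) (inv g) (g ∘ f) ⟩
    inv f ∘ (inv g ∘ (g ∘ f))   ≡⟨ cong (inv f ∘_) (sym (assoc (inv g) g f)) ⟩
    inv f ∘ ((inv g ∘ g) ∘ f)   ≡⟨ cong (λ k → inv f ∘ (k ∘ f)) (invˡ g) ⟩
    inv f ∘ (id ∘ f)            ≡⟨ cong (inv f ∘_) (idˡ f) ⟩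
    inv f ∘ f                   ≡⟨ invˡ f ⟩
    id                          ∎))

  inv-inv : ∀ {a b} (f : Hom a b) → inv (inv f) ≡ f
  inv-inv f = sym (inv-unique (inv f) f (invʳ f))

  inv-id : ∀ {a} → inv (id {a}) ≡ id
  inv-id = sym (inv-unique id id (idˡ id))

  cancel-mid : ∀ {a b c} (f h : Hom b c) (g : Hom a b) →
               (f ∘ g) ∘ inv (h ∘ g) ≡ f ∘ inv h
  cancel-mid f h g = begin
    (f ∘ g) ∘ inv (h ∘ g)       ≡⟨ cong ((f ∘ g) ∘_) (inv-∘ h g) ⟩
    (f ∘ g) ∘ (inv g ∘ inv h)   ≡⟨ assoc f g (inv g ∘ inv h) ⟩
    f ∘ (g ∘ (inv g ∘ inv h))   ≡⟨ cong (f ∘_) (sym (assoc g (inv g) (inv h))) ⟩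
    f ∘ ((g ∘ inv g) ∘ inv h)   ≡⟨ cong (λ k → f ∘ (k ∘ inv h)) (invʳ g) ⟩
    f ∘ (id ∘ inv h)            ≡⟨ cong (f ∘_) (idˡ (inv h)) ⟩
    f ∘ inv h                   ∎

  cancel-inner : ∀ {a c} (f g h : Hom a c) →
                 (f ∘ inv g) ∘ (g ∘ inv h) ≡ f ∘ inv h
  cancel-inner f g h = begin
    (f ∘ inv g) ∘ (g ∘ inv h)   ≡⟨ assoc f (inv g) (g ∘ inv h) ⟩
    f ∘ (inv g ∘ (g ∘ inv h))   ≡⟨ cong (f ∘_) (sym (assoc (inv g) g (inv h))) ⟩
    f ∘ ((inv g ∘ g) ∘ inv h)   ≡⟨ cong (λ k → f ∘ (k ∘ inv h)) (invˡ g) ⟩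
    f ∘ (id ∘ inv h)            ≡⟨ cong (f ∘_) (idˡ (inv h)) ⟩
    f ∘ inv h                   ∎

  inv-quot : ∀ {a c} (f g : Hom a c) → inv (f ∘ inv g) ≡ g ∘ inv f
  inv-quot f g = trans (inv-∘ f (inv g)) (cong (_∘ inv f) (inv-inv g))

module _ (𝔸 : Groupoid) where
  open Groupoid 𝔸

  record Subgroup (a : Obj) : Set₁ where
    field
      mem    : End a → Set
      id-mem : mem id
      ∘-mem  : ∀ {α β} → mem α → mem β → mem (α ∘ β)
      inv-mem : ∀ {α} → mem α → mem (inv α)
  open Subgroup public

  SameSubgroup : ∀ {a} → Subgroup a → Subgroup a → Set
  SameSubgroup G H = ∀ α → (mem G α ⇔ mem H α)

  -- "γ⁻¹ G γ" for γ : b → a, G ≤ End(a): the subgroup {β ∈ End(b) | γ β γ⁻¹ ∈ G}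
  conj : ∀ {a b} → Hom b a → Subgroup a → Subgroup b
  conj {a} {b} γ G = record
    { mem = λ β → mem G (γ ∘ β ∘ inv γ)
    ; id-mem = subst (mem G) (sym e-id) (id-mem G)
    ; ∘-mem = λ {α} {β} p q → subst (mem G) (sym (e-∘ α β)) (∘-mem G p q)
    ; inv-mem = λ {α} p → subst (mem G) (sym (e-inv α)) (inv-mem G p)
    }
    where
    open GroupoidLemmas 𝔸
    open ≡-Reasoning
    e-id : γ ∘ id ∘ inv γ ≡ id
    e-id = trans (cong (γ ∘_) (idˡ (inv γ))) (invʳ γ)
    e-∘ : ∀ α β → γ ∘ (α ∘ β) ∘ inv γ ≡ (γ ∘ α ∘ inv γ) ∘ (γ ∘ β ∘ inv γ)
    e-∘ α β = begin
      γ ∘ (α ∘ β) ∘ inv γ                     ≡⟨ cong (γ ∘_) (assoc α β (inv γ)) ⟩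
      γ ∘ α ∘ (β ∘ inv γ)                     ≡⟨ cong (λ k → γ ∘ α ∘ k) (sym (idˡ (β ∘ inv γ))) ⟩
      γ ∘ α ∘ (id ∘ β ∘ inv γ)                ≡⟨ cong (λ k → γ ∘ α ∘ (k ∘ β ∘ inv γ)) (sym (invˡ γ)) ⟩
      γ ∘ α ∘ ((inv γ ∘ γ) ∘ β ∘ inv γ)       ≡⟨ cong (λ k → γ ∘ α ∘ k) (assoc (inv γ) γ (β ∘ inv γ)) ⟩
      γ ∘ α ∘ (inv γ ∘ γ ∘ β ∘ inv γ)         ≡⟨ cong (γ ∘_) (sym (assoc α (inv γ) (γ ∘ β ∘ inv γ))) ⟩
      γ ∘ (α ∘ inv γ) ∘ (γ ∘ β ∘ inv γ)       ≡⟨ sym (assoc γ (α ∘ inv γ) (γ ∘ β ∘ inv γ)) ⟩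
      (γ ∘ α ∘ inv γ) ∘ (γ ∘ β ∘ inv γ)       ∎
    e-inv : ∀ α → γ ∘ inv α ∘ inv γ ≡ inv (γ ∘ α ∘ inv γ)
    e-inv α = sym (begin
      inv (γ ∘ α ∘ inv γ)           ≡⟨ inv-∘ γ (α ∘ inv γ) ⟩
      inv (α ∘ inv γ) ∘ inv γ       ≡⟨ cong (_∘ inv γ) (inv-∘ α (inv γ)) ⟩
      (inv (inv γ) ∘ inv α) ∘ inv γ ≡⟨ cong (λ k → (k ∘ inv α) ∘ inv γ) (inv-inv γ) ⟩
      (γ ∘ inv α) ∘ inv γ           ≡⟨ assoc γ (inv α) (inv γ) ⟩
      γ ∘ inv α ∘ inv γ             ∎)

-- Kits: for each a, a set 𝒜(a) of subgroups of End(a) (a predicate on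
-- subgroups, extensional in the underlying subset), closed under
-- conjugation by morphisms of 𝔸.

record Kit (𝔸 : Groupoid) : Set₂ where
  open Groupoid 𝔸
  field
    𝒜        : (a : Obj) → Subgroup 𝔸 a → Set₁
    𝒜-ext    : ∀ {a} {G H : Subgroup 𝔸 a} → SameSubgroup 𝔸 G H → 𝒜 a G → 𝒜 a H
    𝒜-conj   : ∀ {a b} (γ : Hom b a) {G : Subgroup 𝔸 a} → 𝒜 a G → 𝒜 b (conj 𝔸 γ G)

-- Presheaves 𝔸^op → Set, with Set modelled by setoids (Bishop sets).
-- Right action: x · γ for x ∈ X(a), γ : b → a, giving an element of X(b).

record Presheaf (𝔸 : Groupoid) : Set₁ where
  open Groupoid 𝔸
  infixl 8 _·_
  field
    F       : Obj → Setoid 0ℓ 0ℓ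
  open module F′ {a} = Setoid (F a) using () renaming (Carrier to Car; _≈_ to _≈_) public
  field
    _·_     : ∀ {a b} → Car {a} → Hom b a → Car {b}
    ·-cong  : ∀ {a b} {x y : Car {a}} (γ : Hom b a) → x ≈ y → (x · γ) ≈ (y · γ)
    ·-id    : ∀ {a} (x : Car {a}) → (x · id) ≈ x
    ·-∘     : ∀ {a b c} (x : Car {a}) (γ : Hom b a) (δ : Hom c b) →
              (x · (γ ∘ δ)) ≈ ((x · γ) · δ)

module _ {𝔸 : Groupoid} where
  open Groupoid 𝔸

  record NatTrans (X Y : Presheaf 𝔸) : Set where
    private
      module X = Presheaf X
      module Y = Presheaf Y
    field
      η      : ∀ {a} → X.Car {a} → Y.Car {a}
      η-cong : ∀ {a} {x y : X.Car {a}} → x X.≈ y → η x Y.≈ η y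
      natural : ∀ {a b} (x : X.Car {a}) (γ : Hom b a) → η (x X.· γ) Y.≈ (η x Y.· γ)
  open NatTrans public

  record _≅_ (X Y : Presheaf 𝔸) : Set where
    private
      module X = Presheaf X
      module Y = Presheaf Y
    field
      to     : NatTrans X Y
      from   : NatTrans Y X
      from∘to : ∀ {a} (x : X.Car {a}) → η from (η to x) X.≈ x
      to∘from : ∀ {a} (y : Y.Car {a}) → η to (η from y) Y.≈ y

module _ {𝔸 : Groupoid} where
  open Groupoid 𝔸

  stabilizer : (X : Presheaf 𝔸) {a : Obj} → Presheaf.Car X {a} → Subgroup 𝔸 a
  stabilizer X {a} x = record
    { mem = λ α → (x · α) ≈ x
    ; id-mem = ·-id x
    ; ∘-mem = λ {α} {β} p q →
        trans≈ (·-∘ x α β) (trans≈ (·-cong β p) q)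
    ; inv-mem = λ {α} p →
        trans≈ (sym≈ (·-cong (inv α) p))
          (trans≈ (sym≈ (·-∘ x α (inv α)))
            (trans≈ (≡⇒≈ (cong (x ·_) (invʳ α))) (·-id x)))
    }
    where
    open Presheaf X
    open Setoid (F a) using () renaming (trans to trans≈; sym to sym≈; reflexive to ≡⇒≈)

  InStPSh : (𝒦 : Kit 𝔸) → Presheaf 𝔸 → Set₁
  InStPSh 𝒦 X = ∀ (a : Obj) (x : Presheaf.Car X {a}) → Kit.𝒜 𝒦 a (stabilizer X x)

-- The coproduct ∐_{i ∈ I} y(a_i)/G_i.
-- At b its elements are pairs (i , γ) with γ : b → a_i, and
-- (i , γ') ~ (i , γ) iff γ' ∘ γ⁻¹ ∈ G_i (distinct summands are never identified).

module _ {𝔸 : Groupoid} where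
  open Groupoid 𝔸
  open GroupoidLemmas 𝔸

  module _ (I : Set) (a : I → Obj) (G : (i : I) → Subgroup 𝔸 (a i)) where

    data QEq {b : Obj} : Σ I (λ i → Hom b (a i)) → Σ I (λ i → Hom b (a i)) → Set where
      qeq : ∀ {i} {γ′ γ : Hom b (a i)} → mem (G i) (γ′ ∘ inv γ) → QEq (i , γ′) (i , γ)

    QEq-isEquiv : ∀ {b} → IsEquivalence (QEq {b})
    QEq-isEquiv = record
      { refl = λ { {i , γ} → qeq (subst (mem (G i)) (sym (invʳ γ)) (id-mem (G i))) }
      ; sym = λ { {i , γ′} {.i , γ} (qeq p) →
                  qeq (subst (mem (G i)) (inv-quot γ′ γ) (inv-mem (G i) p)) }
      ; trans = λ { {i , f} {.i , g} {.i , h} (qeq p) (qeq q) →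
                  qeq (subst (mem (G i)) (cancel-inner f g h) (∘-mem {𝔸 = 𝔸} (G i) {f ∘ inv g} {g ∘ inv h} p q)) }
      }

    ∐y/G : Presheaf 𝔸
    ∐y/G = record
      { F = λ b → record
          { Carrier = Σ I (λ i → Hom b (a i))
          ; _≈_ = QEq
          ; isEquivalence = QEq-isEquiv }
      ; _·_ = λ { (i , γ) δ → (i , γ ∘ δ) }
      ; ·-cong = λ { {x = i , f} {.i , h} δ (qeq p) →
                     qeq (subst (mem (G i)) (sym (cancel-mid f h δ)) p) }
      ; ·-id = λ { (i , γ) → subst (λ k → QEq (i , k) (i , γ)) (sym (idʳ γ))
                                  (IsEquivalence.refl QEq-isEquiv) }
      ; ·-∘ = λ { (i , γ) δ ε → subst (λ k → QEq (i , γ ∘ δ ∘ ε) (i , k)) (sym (assoc γ δ ε))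
                                  (IsEquivalence.refl QEq-isEquiv) }
      }

-- The axiom of choice, in the form: every equivalence relation (setoid)
-- admits a choice of one representative per class, i.e. a function
-- r with r x ≈ x and x ≈ y → r x ≡ r y.

AxiomOfChoice : Set₁
AxiomOfChoice = ∀ (S : Setoid 0ℓ 0ℓ) → let open Setoid S in
  Σ (Carrier → Carrier) λ r → (∀ x → r x ≈ x) × (∀ {x y} → x ≈ y → r x ≡ r y)

-- Pick, by choice, one element x_o in every orbit o of the category of elements of X
-- (p ∼ q when p is a restriction of q along an isomorphism). Every element of X(b) is
-- then x_o · δ for a unique orbit o and some δ : b → a_o, determined up to left
-- multiplication by Stab(x_o); so X ≅ ∐_o y(a_o)/Stab(x_o), and each Stab(x_o) lies in
-- the kit because X ∈ StPSh. Choice also yields excluded middle (Diaconescu), hence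
-- decidable equality and UIP, which makes "x is the chosen representative" a proposition,
-- so that the set of orbits has no spurious duplicates.
module Submission where

open import Defs
open import Axiom.ExcludedMiddle using (ExcludedMiddle)
open import Axiom.UniquenessOfIdentityProofs using (UIP; module Decidable⇒UIP)
open import Data.Bool using (Bool; true; false; _≟_)
open import Data.Product using (Σ; Σ-syntax; _×_; _,_; proj₁; proj₂)
open import Data.Sum using (_⊎_; inj₁; inj₂)
open import Function.Bundles using (_⇔_; mk⇔; Equivalence)
open import Level using (0ℓ)
open import Relation.Binary.Bundles using (Setoid)
open import Relation.Nullary using (Dec; yes; no)
open import Relation.Binary.PropositionalEquality
  using (_≡_; refl; sym; trans; cong)
import Relation.Binary.Reasoning.Setoid as SetoidReasoning

-- r true ≡ r false holds exactly when true and false are identified, i.e. when P holds;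
-- equality on Bool is decidable, so this decides P.
module Diaconescu (ac : AxiomOfChoice) (P : Set) where
  private
    BoolModP : Setoid 0ℓ 0ℓ
    BoolModP = record
      { Carrier = Bool
      ; _≈_ = λ x y → (x ≡ y) ⊎ P
      ; isEquivalence = record
        { refl = inj₁ refl
        ; sym = λ { (inj₁ e) → inj₁ (sym e) ; (inj₂ p) → inj₂ p }
        ; trans = λ { (inj₁ refl) q → q ; (inj₂ p) _ → inj₂ p }
        }
      }

    open Setoid BoolModP using (_≈_)

    r : Bool → Bool
    r = proj₁ (ac BoolModP)

    r-≈ : ∀ x → r x ≈ x
    r-≈ = proj₁ (proj₂ (ac BoolModP))

    r-resp : ∀ {x y} → x ≈ y → r x ≡ r y
    r-resp = proj₂ (proj₂ (ac BoolModP))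

    true≈false⇒P : true ≈ false → P
    true≈false⇒P (inj₁ ())
    true≈false⇒P (inj₂ p) = p

  P-decidable : Dec P
  P-decidable with r true ≟ r false
  ... | yes r-true≡r-false = yes (true≈false⇒P (begin
    true      ≈⟨ r-≈ true ⟨
    r true    ≡⟨ r-true≡r-false ⟩
    r false   ≈⟨ r-≈ false ⟩
    false     ∎))
    where open SetoidReasoning BoolModP
  ... | no r-true≢r-false = no (λ p → r-true≢r-false (r-resp (inj₂ p)))

choice⇒excluded-middle : AxiomOfChoice → ExcludedMiddle 0ℓ
choice⇒excluded-middle ac {P} = Diaconescu.P-decidable ac P

choice⇒UIP : AxiomOfChoice → (A : Set) → UIP A
choice⇒UIP ac A = Decidable⇒UIP.≡-irrelevant (λ x y → choice⇒excluded-middle ac)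

module Transversal (ac : AxiomOfChoice) (S : Setoid 0ℓ 0ℓ) where
  open Setoid S using (Carrier; _≈_)

  private
    r : Carrier → Carrier
    r = proj₁ (ac S)

    r-≈ : ∀ x → r x ≈ x
    r-≈ = proj₁ (proj₂ (ac S))

    r-resp : ∀ {x y} → x ≈ y → r x ≡ r y
    r-resp = proj₂ (proj₂ (ac S))

  Class : Set
  Class = Σ Carrier (λ x → r x ≡ x)

  representative : Class → Carrier
  representative = proj₁

  classOf : Carrier → Class
  classOf x = r x , r-resp (r-≈ x)

  representative-classOf : ∀ x → representative (classOf x) ≈ x
  representative-classOf = r-≈

  Class-≡ : ∀ {c d : Class} → representative c ≡ representative d → c ≡ d
  Class-≡ {x , e} {.x , e′} refl = cong (x ,_) (choice⇒UIP ac Carrier e e′)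

  classOf-unique : ∀ {x} (c : Class) → x ≈ representative c → classOf x ≡ c
  classOf-unique (y , ry≡y) x≈y = Class-≡ (trans (r-resp x≈y) ry≡y)

module PresheafLemmas {𝔸 : Groupoid} (X : Presheaf 𝔸) where
  open Groupoid 𝔸
  open Presheaf X
  private module S {a} = Setoid (F a)

  ·-inv-cancel : ∀ {a b} (x : Car {a}) (γ : Hom b a) → ((x · γ) · inv γ) ≈ x
  ·-inv-cancel x γ = begin
    (x · γ) · inv γ   ≈⟨ ·-∘ x γ (inv γ) ⟨
    x · (γ ∘ inv γ)   ≡⟨ cong (x ·_) (invʳ γ) ⟩
    x · id            ≈⟨ ·-id x ⟩
    x                 ∎
    where open SetoidReasoning (F _)

  ·-transpose : ∀ {a b} {x : Car {a}} {y : Car {b}} (γ : Hom b a) →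
                (x · γ) ≈ y → (y · inv γ) ≈ x
  ·-transpose {x = x} γ xγ≈y = S.trans (·-cong (inv γ) (S.sym xγ≈y)) (·-inv-cancel x γ)

  stabilizer-coset : ∀ {a b} (x : Car {a}) (γ′ γ : Hom b a) →
                     mem (stabilizer X x) (γ′ ∘ inv γ) ⇔ ((x · γ′) ≈ (x · γ))
  stabilizer-coset {a} {b} x γ′ γ = mk⇔ to from
    where
    to : (x · (γ′ ∘ inv γ)) ≈ x → (x · γ′) ≈ (x · γ)
    to fixed = begin
      x · γ′                     ≡⟨ cong (x ·_) (sym γ′γ⁻¹γ≡γ′) ⟩
      x · ((γ′ ∘ inv γ) ∘ γ)     ≈⟨ ·-∘ x (γ′ ∘ inv γ) γ ⟩
      (x · (γ′ ∘ inv γ)) · γ     ≈⟨ ·-cong γ fixed ⟩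
      x · γ                      ∎
      where
      open SetoidReasoning (F b)
      γ′γ⁻¹γ≡γ′ : (γ′ ∘ inv γ) ∘ γ ≡ γ′
      γ′γ⁻¹γ≡γ′ = trans (assoc γ′ (inv γ) γ) (trans (cong (γ′ ∘_) (invˡ γ)) (idʳ γ′))
    from : (x · γ′) ≈ (x · γ) → (x · (γ′ ∘ inv γ)) ≈ x
    from xγ′≈xγ = begin
      x · (γ′ ∘ inv γ)     ≈⟨ ·-∘ x γ′ (inv γ) ⟩
      (x · γ′) · inv γ     ≈⟨ ·-cong (inv γ) xγ′≈xγ ⟩
      (x · γ) · inv γ      ≈⟨ ·-inv-cancel x γ ⟩
      x                    ∎
      where open SetoidReasoning (F a)

module OrbitDecomposition (ac : AxiomOfChoice) {𝔸 : Groupoid} (X : Presheaf 𝔸) where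
  open Groupoid 𝔸
  open Presheaf X
  open PresheafLemmas X
  private module S {a} = Setoid (F a)

  Element : Set
  Element = Σ Obj (λ a → Car {a})

  _∼_ : Element → Element → Set
  (a , x) ∼ (b , y) = Σ[ γ ∈ Hom a b ] ((y · γ) ≈ x)

  orbits : Setoid 0ℓ 0ℓ
  orbits = record
    { Carrier = Element
    ; _≈_ = _∼_
    ; isEquivalence = record
      { refl = λ { {a , x} → id , ·-id x }
      ; sym = λ { (γ , yγ≈x) → inv γ , ·-transpose γ yγ≈x }
      ; trans = λ { {_} {_} {c , z} (γ , yγ≈x) (δ , zδ≈y) →
          δ ∘ γ , S.trans (·-∘ z δ γ) (S.trans (·-cong γ zδ≈y) yγ≈x) }
      }
    }

  open Transversal ac orbits public
    renaming ( Class to Orbit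
             ; classOf to orbitOf
             ; representative-classOf to representative-orbitOf
             ; classOf-unique to orbitOf-unique
             )

  orbitObj : Orbit → Obj
  orbitObj o = proj₁ (representative o)

  orbitRep : (o : Orbit) → Car {orbitObj o}
  orbitRep o = proj₂ (representative o)

  Stab : (o : Orbit) → Subgroup 𝔸 (orbitObj o)
  Stab o = stabilizer X (orbitRep o)

  ∐Orbits : Presheaf 𝔸
  ∐Orbits = ∐y/G Orbit orbitObj Stab

  module ∐ = Presheaf ∐Orbits

  evaluate : ∀ {b} → ∐.Car {b} → Car {b}
  evaluate (o , δ) = orbitRep o · δ

  evaluate-≈ : ∀ {b} {y y′ : ∐.Car {b}} → y ∐.≈ y′ → evaluate y ≈ evaluate y′
  evaluate-≈ (qeq δ′δ⁻¹∈Stab) = Equivalence.to (stabilizer-coset _ _ _) δ′δ⁻¹∈Stab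

  ≈-evaluate : ∀ {b} {o o′ : Orbit} → o ≡ o′ →
               (δ : Hom b (orbitObj o)) (δ′ : Hom b (orbitObj o′)) →
               evaluate (o , δ) ≈ evaluate (o′ , δ′) → (o , δ) ∐.≈ (o′ , δ′)
  ≈-evaluate refl δ δ′ same = qeq (Equivalence.from (stabilizer-coset _ δ δ′) same)

  toRep : ∀ {b} (x : Car {b}) → Hom (orbitObj (orbitOf (b , x))) b
  toRep x = proj₁ (representative-orbitOf (_ , x))

  classify : ∀ {b} → Car {b} → ∐.Car {b}
  classify {b} x = orbitOf (b , x) , inv (toRep x)

  evaluate-classify : ∀ {b} (x : Car {b}) → evaluate (classify x) ≈ x
  evaluate-classify {b} x = ·-transpose (toRep x) (proj₂ (representative-orbitOf (b , x)))

  classify-unique : ∀ {b} (y : ∐.Car {b}) (x : Car {b}) → evaluate y ≈ x → classify x ∐.≈ y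
  classify-unique (o , δ) x evaluates-to-x =
    ≈-evaluate (orbitOf-unique o (δ , evaluates-to-x)) (inv (toRep x)) δ
      (S.trans (evaluate-classify x) (S.sym evaluates-to-x))

  evaluateᴺ : NatTrans ∐Orbits X
  evaluateᴺ = record
    { η = evaluate
    ; η-cong = evaluate-≈
    ; natural = λ { (o , δ) γ → ·-∘ (orbitRep o) δ γ }
    }

  classifyᴺ : NatTrans X ∐Orbits
  classifyᴺ = record
    { η = classify
    ; η-cong = λ {_} {x} {y} x≈y →
        classify-unique (classify y) x (S.trans (evaluate-classify y) (S.sym x≈y))
    ; natural = λ x γ →
        classify-unique (classify x ∐.· γ) (x · γ)
          (S.trans (natural evaluateᴺ (classify x) γ) (·-cong γ (evaluate-classify x)))
    }

  decomposition : X ≅ ∐Orbits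
  decomposition = record
    { to = classifyᴺ
    ; from = evaluateᴺ
    ; from∘to = evaluate-classify
    ; to∘from = λ y → classify-unique y (evaluate y) S.refl
    }

lemma7p5 : AxiomOfChoice →
    (𝔸 : Groupoid) (𝒦 : Kit 𝔸) (X : Presheaf 𝔸) → InStPSh 𝒦 X →
    Σ[ I ∈ Set ] Σ[ a ∈ (I → Groupoid.Obj 𝔸) ] Σ[ G ∈ ((i : I) → Subgroup 𝔸 (a i)) ]
    ((∀ i → Kit.𝒜 𝒦 (a i) (G i)) × (X ≅ ∐y/G I a G))
lemma7p5 ac 𝔸 𝒦 X X∈StPSh =
  Orbit , orbitObj , Stab , (λ o → X∈StPSh (orbitObj o) (orbitRep o)) , decomposition
  where open OrbitDecomposition ac X
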